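{- Let $p$ be a prime and let $(M,v)$ be an $\aleph_0$-saturated valued field of characteristic $p$ with perfect residue field $Mv$ and $p$-divisible value group $vM$. Then: (1) For each $\alpha\in Mv$ there is $a\in\mathcal{O}_v$ such that $\mathbb{F}_p(a^{1/p^\infty})\subseteq M$ and $\mathrm{res}_v(a^{1/p^n})=\alpha^{1/p^n}$ for all $n<\omega$. (2) For each $\gamma\in vM$ there is $a\in M$ such that $\mathbb{F}_p(a^{1/p^\infty})\subseteq M$ and $v(a^{1/p^n})=\gamma/p^n$ for all $n<\omega$.
   Context: Saturation refers to the valued field as a structure in the three-sorted language with sorts for the field, residue field and value group, and symbols for the valuation and residue map. $\mathcal{O}_v$ is the valuation ring; $\mathbb{F}_p(a^{1/p^\infty})$ is the field generated over $\mathbb{F}_p$ by all $p^n$-th roots of $a$ (in particular it is required that all these roots lie in $M$). -}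

module Defs where

open import Level using (Level; _⊔_; Lift; lift) renaming (suc to lsuc; zero to lzero)
open import Data.Nat using (ℕ; zero; suc; _^_)
open import Data.Maybe using (Maybe; just; nothing)
open import Data.Product using (Σ; ∃; _×_; _,_)
open import Data.Sum using (_⊎_)
open import Data.Empty using (⊥)
open import Data.Unit using (⊤)
open import Data.List using (List; []; _∷_)
open import Data.List.Relation.Unary.All as All using (All; []; _∷_)
open import Data.List.Membership.Propositional using (_∈_)
open import Relation.Nullary using (¬_)
open import Relation.Binary.Core using (Rel)
open import Relation.Binary.Structures using (IsTotalOrder)
open import Algebra.Bundles using (CommutativeRing; AbelianGroup)

record IsField {c ℓ} (R : CommutativeRing c ℓ) : Set (c ⊔ ℓ) where
  open CommutativeRing R
  field
    1≉0      : ¬ (1# ≈ 0#)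
    inverse  : ∀ x → ¬ (x ≈ 0#) → ∃ λ y → (x * y) ≈ 1#

module RingOps {c ℓ} (R : CommutativeRing c ℓ) where
  open CommutativeRing R
  pow : Carrier → ℕ → Carrier
  pow x zero    = 1#
  pow x (suc n) = x * pow x n

  times : ℕ → Carrier → Carrier
  times zero    x = 0#
  times (suc n) x = x + times n x

record OrderedAbelianGroup c ℓ : Set (lsuc (c ⊔ ℓ)) where
  field
    abGroup : AbelianGroup c ℓ
  open AbelianGroup abGroup public
  field
    _≤_         : Rel Carrier ℓ
    isTotalOrder : IsTotalOrder _≈_ _≤_
    ≤-translate  : ∀ {a b} d → a ≤ b → (a ∙ d) ≤ (b ∙ d)

  times : ℕ → Carrier → Carrier
  times zero    g = ε
  times (suc n) g = g ∙ times n g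

-- Γ ∪ {∞}, with ∞ represented by nothing

module WithInfinity {c ℓ} (G : OrderedAbelianGroup c ℓ) where
  open OrderedAbelianGroup G

  Γ∞ : Set c
  Γ∞ = Maybe Carrier

  _≈∞_ : Rel Γ∞ ℓ
  just a  ≈∞ just b  = a ≈ b
  nothing ≈∞ nothing = Lift ℓ ⊤
  _       ≈∞ _       = Lift ℓ ⊥

  _≤∞_ : Rel Γ∞ ℓ
  just a  ≤∞ just b  = a ≤ b
  _       ≤∞ nothing = Lift ℓ ⊤
  nothing ≤∞ just _  = Lift ℓ ⊥

  _<∞_ : Rel Γ∞ ℓ
  x <∞ y = (x ≤∞ y) × ¬ (x ≈∞ y)

  _+∞_ : Γ∞ → Γ∞ → Γ∞
  just a +∞ just b = just (a ∙ b)
  _      +∞ _      = nothing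

  -- negation, with the convention -∞ = ∞
  -∞_ : Γ∞ → Γ∞
  -∞ just a  = just (a ⁻¹)
  -∞ nothing = nothing

-- Valued fields, as three-sorted structures (K, residue field k, Γ ∪ {∞})
-- with valuation v : K → Γ ∪ {∞} and residue map res : K → k.
-- Convention: res x = 0 for x outside the valuation ring.

record ValuedField c ℓ : Set (lsuc (c ⊔ ℓ)) where
  field
    K        : CommutativeRing c ℓ
    K-field  : IsField K
    k        : CommutativeRing c ℓ
    k-field  : IsField k
    Γ        : OrderedAbelianGroup c ℓ

  module K = CommutativeRing K
  module k = CommutativeRing k
  module Γ = OrderedAbelianGroup Γ
  open WithInfinity Γ public

  field
    v       : K.Carrier → Γ∞
    res     : K.Carrier → k.Carrier
    v-cong  : ∀ {x y} → x K.≈ y → v x ≈∞ v y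
    v-∞     : ∀ x → v x ≈∞ nothing → x K.≈ K.0#
    v-0     : v K.0# ≈∞ nothing
    v-mul   : ∀ x y → v (x K.* y) ≈∞ (v x +∞ v y)
    v-add   : ∀ x y g → g ≤∞ v x → g ≤∞ v y → g ≤∞ v (x K.+ y)
    -- the value group is exactly vM
    v-onto  : ∀ g → ∃ λ x → v x ≈∞ just g

  InO : K.Carrier → Set ℓ
  InO x = just Γ.ε ≤∞ v x

  field
    res-cong : ∀ {x y} → x K.≈ y → res x k.≈ res y
    res-1    : res K.1# k.≈ k.1#
    res-add  : ∀ x y → InO x → InO y → res (x K.+ y) k.≈ (res x k.+ res y)
    res-mul  : ∀ x y → InO x → InO y → res (x K.* y) k.≈ (res x k.* res y)
    res-ker  : ∀ x → InO x → (res x k.≈ k.0# → just Γ.ε <∞ v x)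
    ker-res  : ∀ x → just Γ.ε <∞ v x → res x k.≈ k.0#
    res-out  : ∀ x → ¬ InO x → res x k.≈ k.0#
    res-onto : ∀ α → ∃ λ x → InO x × (res x k.≈ α)

  open RingOps K public renaming (pow to powK; times to timesK)
  open RingOps k public using () renaming (pow to powk; times to timesk)

data Sort : Set where
  𝕂 𝕜 𝔾 : Sort

Ctx : Set
Ctx = List Sort

data Term (Δ : Ctx) : Sort → Set where
  var  : ∀ {s} → s ∈ Δ → Term Δ s
  0K 1K : Term Δ 𝕂
  _+K_ _*K_ : Term Δ 𝕂 → Term Δ 𝕂 → Term Δ 𝕂
  -K_  : Term Δ 𝕂 → Term Δ 𝕂
  0k 1k : Term Δ 𝕜
  _+k_ _*k_ : Term Δ 𝕜 → Term Δ 𝕜 → Term Δ 𝕜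
  -k_  : Term Δ 𝕜 → Term Δ 𝕜
  0G ∞G : Term Δ 𝔾
  _+G_ : Term Δ 𝔾 → Term Δ 𝔾 → Term Δ 𝔾
  -G_  : Term Δ 𝔾 → Term Δ 𝔾
  val  : Term Δ 𝕂 → Term Δ 𝔾
  resT : Term Δ 𝕂 → Term Δ 𝕜

data Formula : Ctx → Set where
  ⊤f ⊥f : ∀ {Δ} → Formula Δ
  _≐_   : ∀ {Δ s} → Term Δ s → Term Δ s → Formula Δ
  _≤G_  : ∀ {Δ} → Term Δ 𝔾 → Term Δ 𝔾 → Formula Δ
  ¬f_   : ∀ {Δ} → Formula Δ → Formula Δ
  _∧f_ _∨f_ _⇒f_ : ∀ {Δ} → Formula Δ → Formula Δ → Formula Δ
  ∀f ∃f : ∀ {Δ} (s : Sort) → Formula (s ∷ Δ) → Formula Δ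

module Semantics {c ℓ} (M : ValuedField c ℓ) where
  open ValuedField M

  ⟦_⟧ : Sort → Set c
  ⟦ 𝕂 ⟧ = K.Carrier
  ⟦ 𝕜 ⟧ = k.Carrier
  ⟦ 𝔾 ⟧ = Γ∞

  Eq : (s : Sort) → ⟦ s ⟧ → ⟦ s ⟧ → Set ℓ
  Eq 𝕂 = K._≈_
  Eq 𝕜 = k._≈_
  Eq 𝔾 = _≈∞_

  Env : Ctx → Set c
  Env Δ = All ⟦_⟧ Δ

  evalT : ∀ {Δ s} → Term Δ s → Env Δ → ⟦ s ⟧
  evalT (var i)   ρ = All.lookup ρ i
  evalT 0K        ρ = K.0#
  evalT 1K        ρ = K.1#
  evalT (t +K u)  ρ = evalT t ρ K.+ evalT u ρ
  evalT (t *K u)  ρ = evalT t ρ K.* evalT u ρ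
  evalT (-K t)    ρ = K.- evalT t ρ
  evalT 0k        ρ = k.0#
  evalT 1k        ρ = k.1#
  evalT (t +k u)  ρ = evalT t ρ k.+ evalT u ρ
  evalT (t *k u)  ρ = evalT t ρ k.* evalT u ρ
  evalT (-k t)    ρ = k.- evalT t ρ
  evalT 0G        ρ = just Γ.ε
  evalT ∞G        ρ = nothing
  evalT (t +G u)  ρ = evalT t ρ +∞ evalT u ρ
  evalT (-G t)    ρ = -∞ evalT t ρ
  evalT (val t)   ρ = v (evalT t ρ)
  evalT (resT t)  ρ = res (evalT t ρ)

  Sat : ∀ {Δ} → Formula Δ → Env Δ → Set (c ⊔ ℓ)
  Sat ⊤f        ρ = Lift (c ⊔ ℓ) ⊤
  Sat ⊥f        ρ = Lift (c ⊔ ℓ) ⊥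
  Sat (_≐_ {s = s} t u) ρ = Lift (c ⊔ ℓ) (Eq s (evalT t ρ) (evalT u ρ))
  Sat (t ≤G u)  ρ = Lift (c ⊔ ℓ) (evalT t ρ ≤∞ evalT u ρ)
  Sat (¬f φ)    ρ = ¬ Sat φ ρ
  Sat (φ ∧f ψ)  ρ = Sat φ ρ × Sat ψ ρ
  Sat (φ ∨f ψ)  ρ = Sat φ ρ ⊎ Sat ψ ρ
  Sat (φ ⇒f ψ)  ρ = Sat φ ρ → Sat ψ ρ
  Sat (∀f s φ)  ρ = (x : ⟦ s ⟧) → Sat φ (x ∷ ρ)
  Sat (∃f s φ)  ρ = Σ ⟦ s ⟧ λ x → Sat φ (x ∷ ρ)

  -- A (partial) 1-type in a variable of sort s over finitely many
  -- parameters ρ : Env Δ is a set P of formulas φ(x, ρ).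
  FinitelySatisfiable : ∀ {Δ} (s : Sort) → (Formula (s ∷ Δ) → Set) → Env Δ → Set (c ⊔ ℓ)
  FinitelySatisfiable s P ρ =
    (φs : List (Formula (s ∷ _))) → All P φs →
    Σ ⟦ s ⟧ λ x → All (λ φ → Sat φ (x ∷ ρ)) φs

  Realised : ∀ {Δ} (s : Sort) → (Formula (s ∷ Δ) → Set) → Env Δ → Set (c ⊔ ℓ)
  Realised s P ρ = Σ ⟦ s ⟧ λ x → ∀ φ → P φ → Sat φ (x ∷ ρ)

  ℵ₀-Saturated : Set (lsuc lzero ⊔ c ⊔ ℓ)
  ℵ₀-Saturated = (Δ : Ctx) (ρ : Env Δ) (s : Sort) (P : Formula (s ∷ Δ) → Set) →
    FinitelySatisfiable s P ρ → Realised s P ρ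

module _ {c ℓ} (M : ValuedField c ℓ) (p : ℕ) where
  open ValuedField M

  HasChar : Set ℓ
  HasChar = timesK p K.1# K.≈ K.0#

  PerfectResidue : Set (c ⊔ ℓ)
  PerfectResidue = ∀ α → ∃ λ β → powk β p k.≈ α

  PDivisibleValueGroup : Set (c ⊔ ℓ)
  PDivisibleValueGroup = ∀ g → ∃ λ h → Γ.times p h Γ.≈ g

ℵ₀-Saturated : ∀ {c ℓ} → ValuedField c ℓ → Set (lsuc lzero ⊔ c ⊔ ℓ)
ℵ₀-Saturated M = Semantics.ℵ₀-Saturated M

-- Fix N.  Perfectness of Mv (resp. p-divisibility of vM) gives β with β^(p^N) = α
-- (resp. δ with p^N δ = γ); lifting β to b ∈ O_v (resp. choosing b with v b = δ),
-- the element a = b^(p^N) has the compatible roots b^(p^(N-n)) for all n ≤ N.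
-- Asking for such a with a p^n-th root of the right residue (value) for every n is a
-- countable type over α (γ) each finite part of which is thus realised, so
-- ℵ₀-saturation realises all of it at once.
module Submission where

open import Defs
open import Data.Nat using (ℕ; _^_)
open import Data.Nat.Primality using (Prime)
open import Data.Product using (∃; _×_)
open import Data.Maybe using (just)

open import Level using (lift; lower)
open import Data.Nat as ℕ using (zero; suc; _∸_; _⊔_; _≤_; _<_; NonZero)
open import Data.Nat.Properties using (^-distribˡ-+-*; m+[n∸m]≡n; m^n>0; m⊔n≤o⇒m≤o; m⊔n≤o⇒n≤o; ≤-refl)
open import Data.Nat.Primality using (prime⇒nonZero)
open import Data.Maybe using (nothing)
open import Data.Product using (Σ; _,_; proj₁; proj₂)
open import Data.List using ([]; _∷_)
open import Data.List.Relation.Unary.All using (All; []; _∷_)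
open import Data.List.Relation.Unary.Any using (here; there)
open import Data.Unit using (tt)
open import Data.Empty using (⊥-elim)
open import Relation.Nullary using (¬_)
open import Relation.Binary.PropositionalEquality as ≡ using (_≡_; refl; cong; subst)
open import Relation.Binary.Structures using (IsTotalOrder)
open import Algebra.Bundles using (Monoid; CommutativeRing)
import Algebra.Properties.Monoid.Mult as Mult
import Relation.Binary.Reasoning.Setoid as SetoidReasoning

^-split : ∀ p {n N} → n ≤ N → p ^ n ℕ.* p ^ (N ∸ n) ≡ p ^ N
^-split p {n} {N} n≤N = ≡.trans (≡.sym (^-distribˡ-+-* p n (N ∸ n))) (cong (p ^_) (m+[n∸m]≡n n≤N))

module MonoidMultiples {a ℓ} (M : Monoid a ℓ) (p : ℕ) where
  open Monoid M
  open Mult M renaming (_×_ to _×ₘ_)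
  open SetoidReasoning setoid

  ×-split : ∀ x {n N} → n ≤ N → (p ^ n) ×ₘ ((p ^ (N ∸ n)) ×ₘ x) ≈ (p ^ N) ×ₘ x
  ×-split x {n} {N} n≤N = trans (×-assocˡ x (p ^ n) (p ^ (N ∸ n))) (×-congˡ (^-split p n≤N))

  ×-root-iterate : (∀ x → ∃ λ y → p ×ₘ y ≈ x) → ∀ N x → ∃ λ y → (p ^ N) ×ₘ y ≈ x
  ×-root-iterate root zero x = x , ×-homo-1 x
  ×-root-iterate root (suc N) x with root x
  ... | y , py≈x with ×-root-iterate root N y
  ... | z , pᴺz≈y = z , (begin
    (p ℕ.* p ^ N) ×ₘ z   ≈⟨ ×-assocˡ z p (p ^ N) ⟨
    p ×ₘ ((p ^ N) ×ₘ z)  ≈⟨ ×-congʳ p pᴺz≈y ⟩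
    p ×ₘ y               ≈⟨ py≈x ⟩
    x                    ∎)

module RingPowers {c ℓ} (R : CommutativeRing c ℓ) (p : ℕ) where
  open CommutativeRing R hiding (refl)
  open RingOps R
  open Mult *-monoid renaming (_×_ to _×ₘ_)
  open MonoidMultiples *-monoid p

  pow≡× : ∀ x n → pow x n ≡ n ×ₘ x
  pow≡× x zero    = refl
  pow≡× x (suc n) = cong (x *_) (pow≡× x n)

  pow-cong : ∀ n {x y} → x ≈ y → pow x n ≈ pow y n
  pow-cong n {x} {y} rewrite pow≡× x n | pow≡× y n = ×-congʳ n

  pow-split : ∀ x {n N} → n ≤ N → pow (pow x (p ^ (N ∸ n))) (p ^ n) ≈ pow x (p ^ N)
  pow-split x {n} {N} n≤N
    rewrite pow≡× x (p ^ (N ∸ n)) | pow≡× ((p ^ (N ∸ n)) ×ₘ x) (p ^ n) | pow≡× x (p ^ N)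
    = ×-split x n≤N

  pow-root-iterate : (∀ x → ∃ λ y → pow y p ≈ x) → ∀ N x → ∃ λ y → pow y (p ^ N) ≈ x
  pow-root-iterate root N x with ×-root-iterate root′ N x
    where
    root′ : ∀ x → ∃ λ y → p ×ₘ y ≈ x
    root′ x with root x
    ... | y , yᵖ≈x = y , subst (_≈ x) (pow≡× y p) yᵖ≈x
  ... | y , e = y , subst (_≈ x) (≡.sym (pow≡× y (p ^ N))) e

module GroupMultiples {c ℓ} (G : OrderedAbelianGroup c ℓ) (p : ℕ) where
  open OrderedAbelianGroup G hiding (refl; _≤_)
  open Mult monoid renaming (_×_ to _×ₘ_)
  open MonoidMultiples monoid p

  times≡× : ∀ n x → times n x ≡ n ×ₘ x
  times≡× zero    x = refl
  times≡× (suc n) x = cong (x ∙_) (times≡× n x)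

  times-split : ∀ x {n N} → n ≤ N → times (p ^ n) (times (p ^ (N ∸ n)) x) ≈ times (p ^ N) x
  times-split x {n} {N} n≤N
    rewrite times≡× (p ^ (N ∸ n)) x | times≡× (p ^ n) ((p ^ (N ∸ n)) ×ₘ x) | times≡× (p ^ N) x
    = ×-split x n≤N

  times-root-iterate : (∀ x → ∃ λ y → times p y ≈ x) → ∀ N x → ∃ λ y → times (p ^ N) y ≈ x
  times-root-iterate root N x with ×-root-iterate root′ N x
    where
    root′ : ∀ x → ∃ λ y → p ×ₘ y ≈ x
    root′ x with root x
    ... | y , py≈x = y , subst (_≈ x) (times≡× p y) py≈x
  ... | y , e = y , subst (_≈ x) (≡.sym (times≡× (p ^ N) y)) e
module WithInfinityProperties {c ℓ} (G : OrderedAbelianGroup c ℓ) where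
  open OrderedAbelianGroup G hiding (_≤_; refl)
  open OrderedAbelianGroup G using () renaming (refl to ≈-refl)
  open WithInfinity G
  private module O = IsTotalOrder isTotalOrder

  ≈∞-sym : ∀ {x y} → x ≈∞ y → y ≈∞ x
  ≈∞-sym {just _}  {just _}  e = sym e
  ≈∞-sym {nothing} {nothing} e = e
  ≈∞-sym {just _}  {nothing} (lift ())
  ≈∞-sym {nothing} {just _}  (lift ())

  ≈∞-trans : ∀ {x y z} → x ≈∞ y → y ≈∞ z → x ≈∞ z
  ≈∞-trans {just _}  {just _}  {just _}  e f = trans e f
  ≈∞-trans {nothing} {nothing} {nothing} e f = e
  ≈∞-trans {just _}  {nothing} (lift ()) f
  ≈∞-trans {nothing} {just _}  (lift ()) f
  ≈∞-trans {just _}  {just _}  {nothing} e (lift ())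
  ≈∞-trans {nothing} {nothing} {just _}  e (lift ())

  +∞-cong : ∀ {x x′ y y′} → x ≈∞ x′ → y ≈∞ y′ → (x +∞ y) ≈∞ (x′ +∞ y′)
  +∞-cong {just _}  {just _}  {just _}  {just _}  e f = ∙-cong e f
  +∞-cong {just _}  {just _}  {nothing} {nothing} e f = lift tt
  +∞-cong {nothing} {nothing} e f = lift tt
  +∞-cong {just _}  {nothing} (lift ()) f
  +∞-cong {nothing} {just _}  (lift ()) f
  +∞-cong {just _}  {just _}  {just _}  {nothing} e (lift ())
  +∞-cong {just _}  {just _}  {nothing} {just _}  e (lift ())

  ≤∞-respʳ-≈∞ : ∀ {x y z} → x ≤∞ y → y ≈∞ z → x ≤∞ z
  ≤∞-respʳ-≈∞ {just _}  {just _}  {just _}  x≤y e = O.≤-respʳ-≈ e x≤y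
  ≤∞-respʳ-≈∞ {just _}  {_}       {nothing} x≤y e = lift tt
  ≤∞-respʳ-≈∞ {nothing} {_}       {nothing} x≤y e = lift tt
  ≤∞-respʳ-≈∞ {_}       {nothing} {just _}  x≤y (lift ())
  ≤∞-respʳ-≈∞ {nothing} {just _}  {just _}  (lift ()) e

  +∞-nonneg : ∀ x y → just ε ≤∞ x → just ε ≤∞ y → just ε ≤∞ (x +∞ y)
  +∞-nonneg (just g) (just h) 0≤g 0≤h =
    O.trans 0≤h (O.≤-respˡ-≈ (identityˡ h) (≤-translate h 0≤g))
  +∞-nonneg (just _) nothing  _ _ = lift tt
  +∞-nonneg nothing  _        _ _ = lift tt

  +∞-idempotent⇒ε : ∀ x → x ≈∞ (x +∞ x) → ¬ (x ≈∞ nothing) → x ≈∞ just ε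
  +∞-idempotent⇒ε nothing  _ x≉∞ = ⊥-elim (x≉∞ (lift tt))
  +∞-idempotent⇒ε (just g) g≈g+g _ = begin
    g                ≈⟨ identityʳ g ⟨
    g ∙ ε            ≈⟨ ∙-cong ≈-refl (inverseʳ g) ⟨
    g ∙ (g ∙ g ⁻¹)   ≈⟨ assoc g g (g ⁻¹) ⟨
    (g ∙ g) ∙ g ⁻¹   ≈⟨ ∙-cong g≈g+g ≈-refl ⟨
    g ∙ g ⁻¹         ≈⟨ inverseʳ g ⟩
    ε                ∎
    where open SetoidReasoning setoid

  times∞ : ℕ → Γ∞ → Γ∞
  times∞ zero    x = just ε
  times∞ (suc n) x = x +∞ times∞ n x

  times∞-resp-just : ∀ n {x g} → x ≈∞ just g → times∞ n x ≈∞ just (times n g)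
  times∞-resp-just zero    {just _} e = ≈-refl
  times∞-resp-just (suc n) {just h} e = +∞-cong {just h} {just _} {times∞ n (just h)} e (times∞-resp-just n e)
  times∞-resp-just n       {nothing} (lift ())

  times∞-just⁻¹ : ∀ n {x g} → 0 < n → times∞ n x ≈∞ just g → ∃ λ h → x ≈∞ just h × times n h ≈ g
  times∞-just⁻¹ (suc n) {just h}  _ e = h , ≈-refl , ≈∞-trans {just _} {times∞ (suc n) (just h)}
    (≈∞-sym {times∞ (suc n) (just h)} (times∞-resp-just (suc n) ≈-refl)) e
  times∞-just⁻¹ (suc n) {nothing} _ (lift ())

module ValuedFieldProperties {c ℓ} (M : ValuedField c ℓ) where
  open ValuedField M
  open WithInfinityProperties Γ

  v-1 : v K.1# ≈∞ just Γ.ε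
  v-1 = +∞-idempotent⇒ε (v K.1#)
    (≈∞-trans {v K.1#} {v (K.1# K.* K.1#)} (v-cong (K.sym (K.*-identityˡ K.1#))) (v-mul K.1# K.1#))
    (λ v1≈∞ → IsField.1≉0 K-field (v-∞ K.1# v1≈∞))

  v-pow : ∀ {b g} → v b ≈∞ just g → ∀ m → v (powK b m) ≈∞ just (Γ.times m g)
  v-pow vb≈g zero    = v-1
  v-pow {b} {g} vb≈g (suc m) = ≈∞-trans {v (powK b (suc m))} {v b +∞ v (powK b m)}
    (v-mul b (powK b m)) (+∞-cong {v b} {just g} {v (powK b m)} vb≈g (v-pow vb≈g m))

  InO-1 : InO K.1#
  InO-1 = ≤∞-respʳ-≈∞ {just Γ.ε} {just Γ.ε} {v K.1#} (IsTotalOrder.refl Γ.isTotalOrder) (≈∞-sym {v K.1#} v-1)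

  InO-* : ∀ x y → InO x → InO y → InO (x K.* y)
  InO-* x y x∈O y∈O = ≤∞-respʳ-≈∞ {just Γ.ε} {v x +∞ v y} {v (x K.* y)}
    (+∞-nonneg (v x) (v y) x∈O y∈O) (≈∞-sym {v (x K.* y)} (v-mul x y))

  InO-pow : ∀ {b} → InO b → ∀ m → InO (powK b m)
  InO-pow b∈O zero        = InO-1
  InO-pow {b} b∈O (suc m) = InO-* b (powK b m) b∈O (InO-pow b∈O m)

  res-pow : ∀ {b} → InO b → ∀ m → res (powK b m) k.≈ powk (res b) m
  res-pow b∈O zero        = res-1
  res-pow {b} b∈O (suc m) =
    k.trans (res-mul b (powK b m) b∈O (InO-pow b∈O m)) (k.*-cong k.refl (res-pow b∈O m))

v₀ : ∀ {Δ s} → Term (s ∷ Δ) s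
v₀ = var (here refl)

v₁ : ∀ {Δ s t} → Term (t ∷ s ∷ Δ) s
v₁ = var (there (here refl))

v₂ : ∀ {Δ s t u} → Term (u ∷ t ∷ s ∷ Δ) s
v₂ = var (there (there (here refl)))

powT : ∀ {Δ} → Term Δ 𝕂 → ℕ → Term Δ 𝕂
powT t zero    = 1K
powT t (suc n) = t *K powT t n

powTk : ∀ {Δ} → Term Δ 𝕜 → ℕ → Term Δ 𝕜
powTk t zero    = 1k
powTk t (suc n) = t *k powTk t n

timesT : ∀ {Δ} → Term Δ 𝔾 → ℕ → Term Δ 𝔾
timesT t zero    = 0G
timesT t (suc n) = t +G timesT t n

-- hasRoot m θ (x, ρ) says: some y with y^m = x satisfies θ (y, x, ρ).
hasRoot : ∀ {Δ} → ℕ → Formula (𝕂 ∷ 𝕂 ∷ Δ) → Formula (𝕂 ∷ Δ)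
hasRoot m θ = ∃f 𝕂 ((powT v₀ m ≐ v₁) ∧f θ)

module SemanticsProperties {c ℓ} (M : ValuedField c ℓ) where
  open ValuedField M
  open Semantics M hiding (ℵ₀-Saturated)
  open WithInfinityProperties Γ using (times∞)

  evalT-powT : ∀ {Δ} (t : Term Δ 𝕂) n (ρ : Env Δ) → evalT (powT t n) ρ ≡ powK (evalT t ρ) n
  evalT-powT t zero    ρ = refl
  evalT-powT t (suc n) ρ = cong (evalT t ρ K.*_) (evalT-powT t n ρ)

  evalT-powTk : ∀ {Δ} (t : Term Δ 𝕜) n (ρ : Env Δ) → evalT (powTk t n) ρ ≡ powk (evalT t ρ) n
  evalT-powTk t zero    ρ = refl
  evalT-powTk t (suc n) ρ = cong (evalT t ρ k.*_) (evalT-powTk t n ρ)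

  evalT-timesT : ∀ {Δ} (t : Term Δ 𝔾) n (ρ : Env Δ) → evalT (timesT t n) ρ ≡ times∞ n (evalT t ρ)
  evalT-timesT t zero    ρ = refl
  evalT-timesT t (suc n) ρ = cong (evalT t ρ +∞_) (evalT-timesT t n ρ)

  hasRoot-intro : ∀ {Δ} m (θ : Formula (𝕂 ∷ 𝕂 ∷ Δ)) {x ρ} y →
    powK y m K.≈ x → Sat θ (y ∷ x ∷ ρ) → Sat (hasRoot m θ) (x ∷ ρ)
  hasRoot-intro m θ {x} {ρ} y yᵐ≈x θy =
    y , lift (subst (K._≈ x) (≡.sym (evalT-powT v₀ m (y ∷ x ∷ ρ))) yᵐ≈x) , θy

  hasRoot-elim : ∀ {Δ} m (θ : Formula (𝕂 ∷ 𝕂 ∷ Δ)) {x ρ} →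
    Sat (hasRoot m θ) (x ∷ ρ) → ∃ λ y → powK y m K.≈ x × Sat θ (y ∷ x ∷ ρ)
  hasRoot-elim m θ {x} {ρ} (y , lift yᵐ≈x , θy) =
    y , subst (K._≈ x) (evalT-powT v₀ m (y ∷ x ∷ ρ)) yᵐ≈x , θy

  realise-chain : ℵ₀-Saturated M → ∀ {Δ s} (Φ : ℕ → Formula (s ∷ Δ)) (ρ : Env Δ) →
    (∀ N → Σ ⟦ s ⟧ λ x → ∀ n → n ≤ N → Sat (Φ n) (x ∷ ρ)) →
    Σ ⟦ s ⟧ λ x → ∀ n → Sat (Φ n) (x ∷ ρ)
  realise-chain sat {Δ} {s} Φ ρ initial with sat Δ ρ s InChain finitelySatisfiable
    where
    InChain : Formula (s ∷ Δ) → Set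
    InChain φ = ∃ λ n → φ ≡ Φ n

    bound : ∀ {φs} → All InChain φs → ℕ
    bound []             = 0
    bound ((n , _) ∷ qs) = n ⊔ bound qs

    below : ∀ {x N} → (∀ n → n ≤ N → Sat (Φ n) (x ∷ ρ)) →
      ∀ {φs} (qs : All InChain φs) → bound qs ≤ N → All (λ φ → Sat φ (x ∷ ρ)) φs
    below sx []                _ = []
    below sx ((n , refl) ∷ qs) le =
      sx n (m⊔n≤o⇒m≤o n (bound qs) le) ∷ below sx qs (m⊔n≤o⇒n≤o n (bound qs) le)

    finitelySatisfiable : FinitelySatisfiable s InChain ρ
    finitelySatisfiable φs qs with initial (bound qs)
    ... | x , sx = x , below sx qs ≤-refl
  ... | x , sx = x , λ n → sx (Φ n) (n , refl)

module CompatibleRoots {c ℓ} (p : ℕ) (M : ValuedField c ℓ) (sat : ℵ₀-Saturated M) where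
  open ValuedField M
  open Semantics M using (Sat)
  open ValuedFieldProperties M
  open SemanticsProperties M
  open WithInfinityProperties Γ using (≈∞-trans; times∞; times∞-resp-just; times∞-just⁻¹)
  open RingPowers K p using (pow-split)
  open RingPowers k p using () renaming
    (pow-cong to powk-cong; pow-split to powk-split; pow-root-iterate to powk-root-iterate)
  open GroupMultiples Γ p

  residueOfRoot : ℕ → Formula (𝕂 ∷ 𝕂 ∷ 𝕜 ∷ [])
  residueOfRoot n = powTk (resT v₀) (p ^ n) ≐ v₂

  residueRoot : ℕ → Formula (𝕂 ∷ 𝕜 ∷ [])
  residueRoot n = (0G ≤G val v₀) ∧f hasRoot (p ^ n) (residueOfRoot n)

  residue-roots : PerfectResidue M p → ∀ α → ∃ λ a → InO a ×
    (∀ n → ∃ λ b → (powK b (p ^ n) K.≈ a) × (powk (res b) (p ^ n) k.≈ α))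
  residue-roots perf α with realise-chain sat residueRoot (α ∷ []) initial
    where
    initial : ∀ N → Σ K.Carrier λ a → ∀ n → n ≤ N → Sat (residueRoot n) (a ∷ α ∷ [])
    initial N with powk-root-iterate perf N α
    ... | β , βᴺ≈α with res-onto β
    ... | b , b∈O , resb≈β = powK b (p ^ N) , λ n n≤N →
      lift (InO-pow b∈O (p ^ N)) ,
      hasRoot-intro (p ^ n) (residueOfRoot n) (powK b (p ^ (N ∸ n))) (pow-split b n≤N)
        (lift (subst (k._≈ α) (≡.sym (evalT-powTk (resT v₀) (p ^ n) _)) (residue n≤N)))
      where
      residue : ∀ {n} → n ≤ N → powk (res (powK b (p ^ (N ∸ n)))) (p ^ n) k.≈ α
      residue {n} n≤N = begin
        powk (res (powK b (p ^ (N ∸ n)))) (p ^ n)  ≈⟨ powk-cong (p ^ n) (res-pow b∈O (p ^ (N ∸ n))) ⟩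
        powk (powk (res b) (p ^ (N ∸ n))) (p ^ n)  ≈⟨ powk-split (res b) n≤N ⟩
        powk (res b) (p ^ N)                       ≈⟨ powk-cong (p ^ N) resb≈β ⟩
        powk β (p ^ N)                             ≈⟨ βᴺ≈α ⟩
        α                                          ∎
        where open SetoidReasoning k.setoid
  ... | a , sa = a , lower (proj₁ (sa 0)) , λ n → root n (hasRoot-elim (p ^ n) (residueOfRoot n) (proj₂ (sa n)))
    where
    root : ∀ n → ∃ (λ y → powK y (p ^ n) K.≈ a × Sat (residueOfRoot n) (y ∷ a ∷ α ∷ [])) →
      ∃ λ b → (powK b (p ^ n) K.≈ a) × (powk (res b) (p ^ n) k.≈ α)
    root n (y , yⁿ≈a , lift e) = y , yⁿ≈a , subst (k._≈ α) (evalT-powTk (resT v₀) (p ^ n) _) e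

  valueOfRoot : ℕ → Formula (𝕂 ∷ 𝕂 ∷ 𝔾 ∷ [])
  valueOfRoot n = timesT (val v₀) (p ^ n) ≐ v₂

  valueRoot : ℕ → Formula (𝕂 ∷ 𝔾 ∷ [])
  valueRoot n = hasRoot (p ^ n) (valueOfRoot n)

  value-roots : .{{NonZero p}} → PDivisibleValueGroup M p → ∀ γ → ∃ λ a →
    (∀ n → ∃ λ b → (powK b (p ^ n) K.≈ a) ×
      (∃ λ δ → (v b ≈∞ just δ) × (Γ.times (p ^ n) δ Γ.≈ γ)))
  value-roots pdiv γ with realise-chain sat valueRoot (just γ ∷ []) initial
    where
    initial : ∀ N → Σ K.Carrier λ a → ∀ n → n ≤ N → Sat (valueRoot n) (a ∷ just γ ∷ [])
    initial N with times-root-iterate pdiv N γ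
    ... | δ , pᴺδ≈γ with v-onto δ
    ... | b , vb≈δ = powK b (p ^ N) , λ n n≤N →
      hasRoot-intro (p ^ n) (valueOfRoot n) (powK b (p ^ (N ∸ n))) (pow-split b n≤N)
        (lift (subst (_≈∞ just γ) (≡.sym (evalT-timesT (val v₀) (p ^ n) _)) (value n≤N)))
      where
      value : ∀ {n} → n ≤ N → times∞ (p ^ n) (v (powK b (p ^ (N ∸ n)))) ≈∞ just γ
      value {n} n≤N = ≈∞-trans {times∞ (p ^ n) (v (powK b (p ^ (N ∸ n))))}
        (times∞-resp-just (p ^ n) (v-pow vb≈δ (p ^ (N ∸ n))))
        (Γ.trans (times-split δ n≤N) pᴺδ≈γ)
  ... | a , sa = a , λ n → root n (hasRoot-elim (p ^ n) (valueOfRoot n) (sa n))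
    where
    root : ∀ n → ∃ (λ y → powK y (p ^ n) K.≈ a × Sat (valueOfRoot n) (y ∷ a ∷ just γ ∷ [])) →
      ∃ λ b → (powK b (p ^ n) K.≈ a) × (∃ λ δ → (v b ≈∞ just δ) × (Γ.times (p ^ n) δ Γ.≈ γ))
    root n (y , yⁿ≈a , lift e) = y , yⁿ≈a ,
      times∞-just⁻¹ (p ^ n) (m^n>0 p n) (subst (_≈∞ just γ) (evalT-timesT (val v₀) (p ^ n) _) e)

lemma2p20 : ∀ {c ℓ} (p : ℕ) → Prime p → (M : ValuedField c ℓ) →
    HasChar M p → ℵ₀-Saturated M →
    PerfectResidue M p → PDivisibleValueGroup M p →
    let open ValuedField M in
    (∀ α → ∃ λ a → InO a ×
      (∀ n → ∃ λ b → (powK b (p ^ n) K.≈ a) × (powk (res b) (p ^ n) k.≈ α)))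
    ×
    (∀ γ → ∃ λ a →
      (∀ n → ∃ λ b → (powK b (p ^ n) K.≈ a) ×
        (∃ λ δ → (v b ≈∞ just δ) × (Γ.times (p ^ n) δ Γ.≈ γ))))
lemma2p20 p p-prime M _ sat perf pdiv = residue-roots perf , value-roots pdiv
  where
  open CompatibleRoots p M sat
  instance
    p≢0 : NonZero p
    p≢0 = prime⇒nonZero p-prime
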